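{- Let $N\ge 2$, $r=\lfloor N/2\rfloor$, and let $\mathcal{Q}$ be a period-$1$ quiver on the vertices $x_1,\dots,x_N$ whose exchange matrix has the form $$B=c_1B^{(1)}+\cdots+c_rB^{(r)}+B',$$ where $c_1,\dots,c_r\in\mathbb{Z}$, $B^{(t)}$ is the matrix of the primitive quiver $P_N^{(t)}$, and $B'$ is a skew-symmetric integer matrix whose first row and first column are zero. Then there exists a nonzero period-$1$ weight function $w:\{x_1,\dots,x_N\}\to\mathbb{Z}$ on $\mathcal{Q}$ if and only if $$[c_1]_-+\cdots+[c_r]_-=1\quad\text{if }N\text{ is odd},\qquad 2[c_1]_-+\cdots+2[c_{r-1}]_-+[c_r]_-=2\quad\text{if }N\text{ is even}.$$ Moreover, a period-$1$ weight function is unique up to an integer multiple.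
   Context: A quiver on vertices $x_1,\dots,x_N$ (no loops, no $2$-cycles) is encoded by a skew-symmetric integer matrix $B=(b_{ij})$: if $b_{ij}>0$ there are $b_{ij}$ arrows $x_i\to x_j$, if $b_{ij}<0$ there are $-b_{ij}$ arrows $x_j\to x_i$. For an integer $c$ write $[c]_+=\max(c,0)$ and $[c]_-=\max(-c,0)$. The mutation $\mu_k$ at $x_k$: for every path $x_i\to x_k\to x_j$ add an arrow $x_i\to x_j$; reverse all arrows incident to $x_k$; remove the $2$-cycles created. The quiver is of period $1$ if the mutated quiver $\mu_1(\mathcal{Q})$, with its vertices relabeled $x_i\mapsto x_{i-1}$ for $i\ge2$ and $x_1\mapsto x_N$, coincides with $\mathcal{Q}$. A weight function is a map $w:\{x_1,\dots,x_N\}\to\mathbb{Z}$, $w_i:=w(x_i)$; its mutation at $x_k$ is $\mu_k(w)(x_k)=-w_k$ and $\mu_k(w)(x_i)=w_i+[b_{ki}]_+w_k$ for $i\neq k$. A weight function on a period-$1$ quiver is of period $1$ if $\mu_1(w)(x_1)=w_N$ and $\mu_1(w)(x_{i+1})=w_i$ for $1\le i\le N-1$ (i.e. it is carried back to $w$ by the same relabeling). For $1\le t\le N/2$, the primitive quiver $P_N^{(t)}$ has exactly one arrow between $x_i$ and $x_j$ for each unordered pair $\{i,j\}\subset\{1,\dots,N\}$ with $i-j\equiv\pm t \pmod N$, oriented from the vertex with the larger label to the one with the smaller label, and no other arrows; $B^{(t)}$ denotes its matrix. -}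

module Defs where

open import Data.Nat as ℕ using (ℕ; zero; suc; _<?_)
open import Data.Nat.DivMod using (_%_; m%n<n)
open import Data.Integer as ℤ using (ℤ; +_; -_; _+_; _*_; _-_; _⊔_)
open import Data.Fin as Fin using (Fin; zero; suc; toℕ; fromℕ<)
open import Data.Bool using (if_then_else_; _∨_)
open import Data.Unit using (⊤)
open import Data.Product using (_×_)
open import Relation.Nullary using (does)
open import Relation.Binary.PropositionalEquality using (_≡_)

-- Vertices x_1,…,x_N are represented by Fin N (x_{i+1} ↦ index i; x_1 ↦ zero).
-- An exchange matrix / quiver: B i j = b_{ij}.
Matrix : ℕ → Set
Matrix N = Fin N → Fin N → ℤ

Weight : ℕ → Set
Weight N = Fin N → ℤ

IsSkew : ∀ {N} → Matrix N → Set
IsSkew B = ∀ i j → B j i ≡ - B i j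

[_]₊ : ℤ → ℤ
[ c ]₊ = c ⊔ + 0

[_]₋ : ℤ → ℤ
[ c ]₋ = (- c) ⊔ + 0

-- Quiver mutation at k, in matrix form:
-- reverse arrows at k; otherwise add b_ik b_kj arrows i→j for paths i→k→j,
-- add arrows j→i for paths j→k→i, and cancel 2-cycles (net count).
mutate : ∀ {N} → Fin N → Matrix N → Matrix N
mutate k B i j =
  if does (i Fin.≟ k) ∨ does (j Fin.≟ k)
  then - B i j
  else B i j + [ B i k ]₊ * [ B k j ]₊ - [ B i k ]₋ * [ B k j ]₋

mutateW : ∀ {N} → Fin N → Matrix N → Weight N → Weight N
mutateW k B w i =
  if does (i Fin.≟ k) then - w k else w i + [ B k i ]₊ * w k

shift : ∀ {N} → Fin N → Fin N
shift {suc n} i = fromℕ< (m%n<n (suc (toℕ i)) (suc n))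

-- Period 1 quiver: μ_1(Q) relabeled by x_i ↦ x_{i-1}, x_1 ↦ x_N equals Q,
-- i.e. μ_1(B)_{i+1,j+1} = B_{ij} (indices mod N).
IsPeriod1Quiver : ∀ {N} → Matrix N → Set
IsPeriod1Quiver {zero} B = ⊤
IsPeriod1Quiver {suc n} B = ∀ i j → mutate zero B (shift i) (shift j) ≡ B i j

IsPeriod1Weight : ∀ {N} → Matrix N → Weight N → Set
IsPeriod1Weight {zero} B w = ⊤
IsPeriod1Weight {suc n} B w = ∀ i → mutateW zero B w (shift i) ≡ w i

FirstRowColZero : ∀ {N} → Matrix N → Set
FirstRowColZero {zero} B = ⊤
FirstRowColZero {suc n} B = (∀ j → B zero j ≡ + 0) × (∀ i → B i zero ≡ + 0)

-- Primitive quiver P_N^{(t)}: one arrow between x_i, x_j iff i - j ≡ ±t (mod N),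
-- oriented from the larger label to the smaller; B^{(t)}_{ij} = +1 if i > j, -1 if i < j.
-- (i - j ≡ t  ⇔  i ≡ j + t;   i - j ≡ -t  ⇔  i + t ≡ j   (mod N))
prim : (N t : ℕ) → Matrix N
prim (suc n) t i j =
  if does (((toℕ i ℕ.+ t) % suc n) ℕ.≟ (toℕ j % suc n))
     ∨ does (((toℕ j ℕ.+ t) % suc n) ℕ.≟ (toℕ i % suc n))
  then (if does (toℕ j <? toℕ i) then + 1
        else if does (toℕ i <? toℕ j) then - (+ 1) else + 0)
  else + 0

-- sumTo m f = f 1 + f 2 + … + f m
sumTo : ℕ → (ℕ → ℤ) → ℤ
sumTo zero f = + 0
sumTo (suc m) f = sumTo m f + f (suc m)

primCombo : (N r : ℕ) → (ℕ → ℤ) → Matrix N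
primCombo N r c i j = sumTo r (λ t → c t * prim N t i j)

-- A period-1 weight w is pinned down by w₁: mutating at x₁ and shifting gives
-- w_{j+1} = w_j - [b_{1,j+1}]₊ w₁ for j < N, so w_{j+1} = w₁ (1 - S_j) with
-- S_j = [b_{1,2}]₊ + ⋯ + [b_{1,j+1}]₊, and the remaining condition -w₁ = w_N forces
-- w₁ (S_{N-1} - 2) = 0. Hence a nonzero period-1 weight exists iff S_{N-1} = 2, and
-- then every period-1 weight is a multiple of it (otherwise only w = 0 is).
-- In P_N^{(t)} the vertex x₁ is joined exactly to x_{1+t} and x_{1+N-t}, by arrows
-- into x₁; as B′ has zero first row, b_{1,m+1} = -c_{min(m,N-m)}, so S_{N-1} counts
-- every [c_t]₋ twice, except [c_{N/2}]₋ once when N is even.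
module Submission where

open import Defs
open import Data.Nat as ℕ
  using (ℕ; zero; suc; _≤_; _<_; _∸_; z≤n; s≤s; s<s)
open import Data.Nat.Properties as ℕ
  using (≤-refl; ≤-trans; <⇒≤; <⇒≢; <⇒≱; ≤-antisym; ≮⇒≥; m≤n⇒m≤1+n; m≤n⇒m<n∨m≡n)
open import Data.Nat.DivMod using (_%_; _/_; m%n<n; m<n⇒m%n≡m; n%n≡0; m≡m%n+[m/n]*n)
open import Data.Nat.Divisibility using (_∣_; divides; m%n≡0⇒n∣m)
open import Data.Integer as ℤ using (ℤ; +_; _+_; _*_; _-_; -_)
import Data.Integer.Properties as ℤ
open import Data.Integer.Tactic.RingSolver using (solve-∀)
open import Data.Fin using (Fin; zero; suc; toℕ; fromℕ<)
open import Data.Fin.Properties using (toℕ-fromℕ<; toℕ-injective; toℕ<n)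
open import Data.Bool using (if_then_else_)
open import Data.Empty using (⊥-elim)
open import Data.Product using (_×_; ∃-syntax; _,_)
open import Data.Sum as Sum using (_⊎_; inj₁; inj₂)
open import Function.Bundles using (_⇔_; mk⇔)
import Function.Properties.Equivalence as ⇔
open import Relation.Nullary using (¬_; Dec; does; yes; no)
open import Relation.Nullary.Decidable using (_⊎-dec_; dec-true; dec-false)
open import Relation.Binary.PropositionalEquality
open ≡-Reasoning

sumTo-cong : ∀ m {f g : ℕ → ℤ} → (∀ j → 1 ≤ j → j ≤ m → f j ≡ g j) →
  sumTo m f ≡ sumTo m g
sumTo-cong zero     f≡g = refl
sumTo-cong (suc m) f≡g = cong₂ _+_
  (sumTo-cong m (λ j 1≤j j≤m → f≡g j 1≤j (m≤n⇒m≤1+n j≤m)))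
  (f≡g (suc m) (s≤s z≤n) ≤-refl)

sumTo-zero : ∀ m {g : ℕ → ℤ} → (∀ t → 1 ≤ t → t ≤ m → g t ≡ + 0) → sumTo m g ≡ + 0
sumTo-zero zero    g≡0 = refl
sumTo-zero (suc m) {g} g≡0 = begin
  sumTo m g + g (suc m)  ≡⟨ cong₂ _+_ (sumTo-zero m (λ t 1≤t t≤m → g≡0 t 1≤t (m≤n⇒m≤1+n t≤m)))
                                      (g≡0 (suc m) (s≤s z≤n) ≤-refl) ⟩
  + 0 + + 0              ≡⟨⟩
  + 0                    ∎

sumTo-single : ∀ m {g : ℕ → ℤ} {t₀} → 1 ≤ t₀ → t₀ ≤ m →
  (∀ t → 1 ≤ t → t ≤ m → t ≢ t₀ → g t ≡ + 0) → sumTo m g ≡ g t₀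
sumTo-single zero    () z≤n _
sumTo-single (suc m) {g} {t₀} 1≤t₀ t₀≤1+m g≡0 with m≤n⇒m<n∨m≡n t₀≤1+m
... | inj₁ (s<s t₀≤m) = begin
  sumTo m g + g (suc m)
    ≡⟨ cong₂ _+_ (sumTo-single m 1≤t₀ t₀≤m (λ t 1≤t t≤m → g≡0 t 1≤t (m≤n⇒m≤1+n t≤m)))
                 (g≡0 (suc m) (s≤s z≤n) ≤-refl (λ eq → <⇒≢ (s≤s t₀≤m) (sym eq))) ⟩
  g t₀ + + 0             ≡⟨ ℤ.+-identityʳ (g t₀) ⟩
  g t₀                   ∎
... | inj₂ refl = begin
  sumTo m g + g (suc m)
    ≡⟨ cong (_+ g (suc m))
            (sumTo-zero m (λ t 1≤t t≤m → g≡0 t 1≤t (m≤n⇒m≤1+n t≤m) (<⇒≢ (s≤s t≤m)))) ⟩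
  + 0 + g (suc m)        ≡⟨ ℤ.+-identityˡ (g (suc m)) ⟩
  g (suc m)              ∎

sumTo-+ : ∀ a b (h : ℕ → ℤ) → sumTo (a ℕ.+ b) h ≡ sumTo a h + sumTo b (λ k → h (a ℕ.+ k))
sumTo-+ a zero    h rewrite ℕ.+-identityʳ a = sym (ℤ.+-identityʳ (sumTo a h))
sumTo-+ a (suc b) h rewrite ℕ.+-suc a b = begin
  sumTo (a ℕ.+ b) h + h (suc (a ℕ.+ b))
    ≡⟨ cong (_+ h (suc (a ℕ.+ b))) (sumTo-+ a b h) ⟩
  sumTo a h + sumTo b (λ k → h (a ℕ.+ k)) + h (suc (a ℕ.+ b))
    ≡⟨ ℤ.+-assoc (sumTo a h) _ _ ⟩
  sumTo a h + (sumTo b (λ k → h (a ℕ.+ k)) + h (suc (a ℕ.+ b)))  ∎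

sumTo-suc : ∀ m (f : ℕ → ℤ) → sumTo (suc m) f ≡ f 1 + sumTo m (λ k → f (suc k))
sumTo-suc m f = trans (sumTo-+ 1 m f) (cong (_+ sumTo m (λ k → f (suc k))) (ℤ.+-identityˡ (f 1)))

sumTo-reverse : ∀ m (f : ℕ → ℤ) → sumTo m (λ k → f (suc m ∸ k)) ≡ sumTo m f
sumTo-reverse zero    f = refl
sumTo-reverse (suc m) f = begin
  sumTo m (λ k → f (suc (suc m) ∸ k)) + f (suc m ∸ m)
    ≡⟨ cong₂ _+_ (sumTo-cong m (λ k _ k≤m → cong f (ℕ.+-∸-assoc 1 (m≤n⇒m≤1+n k≤m))))
                 (cong f (ℕ.m+n∸n≡m 1 m)) ⟩
  sumTo m (λ k → f (suc (suc m ∸ k))) + f 1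
    ≡⟨ cong (_+ f 1) (sumTo-reverse m (λ k → f (suc k))) ⟩
  sumTo m (λ k → f (suc k)) + f 1
    ≡⟨ ℤ.+-comm _ (f 1) ⟩
  f 1 + sumTo m (λ k → f (suc k))
    ≡⟨ sumTo-suc m f ⟨
  sumTo (suc m) f  ∎

-- `shift i` is definitionally `fromℕ-mod (suc (toℕ i))`.
fromℕ-mod : ∀ {n} → ℕ → Fin (suc n)
fromℕ-mod {n} m = fromℕ< (m%n<n m (suc n))

toℕ-fromℕ-mod : ∀ {n m} → m < suc n → toℕ (fromℕ-mod {n} m) ≡ m
toℕ-fromℕ-mod {n} {m} m<1+n = trans (toℕ-fromℕ< (m%n<n m (suc n))) (m<n⇒m%n≡m m<1+n)

fromℕ-mod-toℕ : ∀ {n} (i : Fin (suc n)) → fromℕ-mod (toℕ i) ≡ i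
fromℕ-mod-toℕ i = toℕ-injective (toℕ-fromℕ-mod (toℕ<n i))

fromℕ-mod-self : ∀ {n} → fromℕ-mod {n} (suc n) ≡ zero
fromℕ-mod-self {n} = toℕ-injective (trans (toℕ-fromℕ< (m%n<n (suc n) (suc n))) (n%n≡0 (suc n)))

shift-fromℕ-mod : ∀ {n m} → m < suc n → shift (fromℕ-mod {n} m) ≡ fromℕ-mod (suc m)
shift-fromℕ-mod m<1+n = cong (λ k → fromℕ-mod (suc k)) (toℕ-fromℕ-mod m<1+n)

mutateW-zero : ∀ {n} (B : Matrix (suc n)) w (j : Fin (suc n)) → toℕ j ≢ 0 →
  mutateW zero B w j ≡ w j + [ B zero j ]₊ * w zero
mutateW-zero B w zero    j≢0 = ⊥-elim (j≢0 refl)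
mutateW-zero B w (suc j) _   = refl

module _ {n} (B : Matrix (suc n)) where

  firstRowSum : ℕ → ℤ
  firstRowSum m = sumTo m (λ j → [ B zero (fromℕ-mod j) ]₊)

  standardWeight : Weight (suc n)
  standardWeight i = + 1 - firstRowSum (toℕ i)

  module _ {w : Weight (suc n)} (w-per : IsPeriod1Weight B w) where

    period1-step : ∀ m → m < n →
      w (fromℕ-mod (suc m)) + [ B zero (fromℕ-mod (suc m)) ]₊ * w zero ≡ w (fromℕ-mod m)
    period1-step m m<n = begin
      w (fromℕ-mod (suc m)) + [ B zero (fromℕ-mod (suc m)) ]₊ * w zero
        ≡⟨ mutateW-zero B w _ (λ eq → ℕ.0≢1+n (trans (sym eq) (toℕ-fromℕ-mod (s≤s m<n)))) ⟨
      mutateW zero B w (fromℕ-mod (suc m))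
        ≡⟨ cong (mutateW zero B w) (shift-fromℕ-mod (m≤n⇒m≤1+n m<n)) ⟨
      mutateW zero B w (shift (fromℕ-mod m))
        ≡⟨ w-per (fromℕ-mod m) ⟩
      w (fromℕ-mod m)  ∎

    period1-wrap : - w zero ≡ w (fromℕ-mod n)
    period1-wrap = begin
      mutateW zero B w zero
        ≡⟨ cong (mutateW zero B w) (trans (shift-fromℕ-mod ≤-refl) fromℕ-mod-self) ⟨
      mutateW zero B w (shift (fromℕ-mod n))
        ≡⟨ w-per (fromℕ-mod n) ⟩
      w (fromℕ-mod n)  ∎

    period1-partial : ∀ m → m ≤ n → w (fromℕ-mod m) ≡ w zero * (+ 1 - firstRowSum m)
    period1-partial zero    _   = trans (cong w (fromℕ-mod-toℕ zero)) (x≡x*1 (w zero))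
      where
      x≡x*1 : ∀ x → x ≡ x * (+ 1 - + 0)
      x≡x*1 = solve-∀
    period1-partial (suc m) m<n = begin
      w (fromℕ-mod (suc m))
        ≡⟨ move (w (fromℕ-mod (suc m))) p (w zero) ⟩
      w (fromℕ-mod (suc m)) + p * w zero - p * w zero
        ≡⟨ cong (_- p * w zero) (trans (period1-step m m<n) (period1-partial m (<⇒≤ m<n))) ⟩
      w zero * (+ 1 - firstRowSum m) - p * w zero
        ≡⟨ regroup (w zero) (firstRowSum m) p ⟩
      w zero * (+ 1 - (firstRowSum m + p))  ∎
      where
      p = [ B zero (fromℕ-mod (suc m)) ]₊
      move : ∀ x p w₀ → x ≡ x + p * w₀ - p * w₀
      move = solve-∀
      regroup : ∀ w₀ s p → w₀ * (+ 1 - s) - p * w₀ ≡ w₀ * (+ 1 - (s + p))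
      regroup = solve-∀

    period1-multiple : ∀ i → w i ≡ w zero * standardWeight i
    period1-multiple i = begin
      w i                 ≡⟨ cong w (fromℕ-mod-toℕ i) ⟨
      w (fromℕ-mod (toℕ i)) ≡⟨ period1-partial (toℕ i) (ℕ.s≤s⁻¹ (toℕ<n i)) ⟩
      w zero * standardWeight i ∎

    period1-closing : w zero * firstRowSum n ≡ w zero * + 2
    period1-closing = begin
      w zero * firstRowSum n
        ≡⟨ expand (w zero) (firstRowSum n) ⟩
      w zero * + 2 - (w zero + w zero * (+ 1 - firstRowSum n))
        ≡⟨ cong (λ y → w zero * + 2 - (w zero + y)) (trans period1-wrap (period1-partial n ≤-refl)) ⟨
      w zero * + 2 - (w zero + - w zero)
        ≡⟨ cancel (w zero) ⟩
      w zero * + 2  ∎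
      where
      expand : ∀ x s → x * s ≡ x * + 2 - (x + x * (+ 1 - s))
      expand = solve-∀
      cancel : ∀ x → x * + 2 - (x + - x) ≡ x * + 2
      cancel = solve-∀

  period1-vanishes : firstRowSum n ≢ + 2 → ∀ {w} → IsPeriod1Weight B w → ∀ i → w i ≡ + 0
  period1-vanishes S≢2 {w} w-per i with w zero ℤ.≟ + 0
  ... | yes w₀≡0 = trans (period1-multiple w-per i) (cong (_* standardWeight i) w₀≡0)
  ... | no  w₀≢0 =
    ⊥-elim (S≢2 (ℤ.*-cancelˡ-≡ (w zero) _ _ {{ℤ.≢-nonZero w₀≢0}} (period1-closing w-per)))

  zero-period1 : IsPeriod1Weight B (λ _ → + 0)
  zero-period1 i = vanish (shift i)
    where
    vanish : ∀ j → mutateW zero B (λ _ → + 0) j ≡ + 0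
    vanish zero    = refl
    vanish (suc j) = trans (ℤ.+-identityˡ _) (ℤ.*-zeroʳ [ B zero (suc j) ]₊)

  standardWeight-period1 : firstRowSum n ≡ + 2 → IsPeriod1Weight B standardWeight
  standardWeight-period1 S≡2 i with m≤n⇒m<n∨m≡n (ℕ.s≤s⁻¹ (toℕ<n i))
  ... | inj₂ i≡n = begin
    mutateW zero B standardWeight (shift i)
      ≡⟨ cong (mutateW zero B standardWeight)
              (trans (cong (λ k → fromℕ-mod (suc k)) i≡n) fromℕ-mod-self) ⟩
    + 1 - + 2                       ≡⟨ cong (_-_ (+ 1)) S≡2 ⟨
    + 1 - firstRowSum n             ≡⟨ cong (λ k → + 1 - firstRowSum k) i≡n ⟨
    standardWeight i                ∎
  ... | inj₁ i<n = begin
    mutateW zero B standardWeight (shift i)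
      ≡⟨ mutateW-zero B standardWeight (shift i) (λ eq → ℕ.0≢1+n (trans (sym eq) toℕ-shift)) ⟩
    + 1 - firstRowSum (toℕ (shift i)) + p * (+ 1 - + 0)
      ≡⟨ cong (λ k → + 1 - firstRowSum k + p * (+ 1 - + 0)) toℕ-shift ⟩
    + 1 - (firstRowSum (toℕ i) + p) + p * (+ 1 - + 0)
      ≡⟨ cancel (firstRowSum (toℕ i)) p ⟩
    standardWeight i                ∎
    where
    toℕ-shift : toℕ (shift i) ≡ suc (toℕ i)
    toℕ-shift = toℕ-fromℕ-mod (s≤s i<n)
    p = [ B zero (shift i) ]₊
    cancel : ∀ s p → + 1 - (s + p) + p * (+ 1 - + 0) ≡ + 1 - s
    cancel = solve-∀

  nonzero-period1⇔ : (∃[ w ] (IsPeriod1Weight B w × ∃[ i ] w i ≢ + 0)) ⇔ (firstRowSum n ≡ + 2)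
  nonzero-period1⇔ = mk⇔ to (λ S≡2 → standardWeight , standardWeight-period1 S≡2 , zero , λ ())
    where
    to : ∃[ w ] (IsPeriod1Weight B w × ∃[ i ] w i ≢ + 0) → firstRowSum n ≡ + 2
    to (w , w-per , i , wᵢ≢0) with firstRowSum n ℤ.≟ + 2
    ... | yes S≡2 = S≡2
    ... | no  S≢2 = ⊥-elim (wᵢ≢0 (period1-vanishes S≢2 w-per i))

  period1-unique : ∃[ w₀ ] (IsPeriod1Weight B w₀
    × (∀ w → IsPeriod1Weight B w → ∃[ k ] (∀ i → w i ≡ k * w₀ i)))
  period1-unique with firstRowSum n ℤ.≟ + 2
  ... | yes S≡2 = standardWeight , standardWeight-period1 S≡2 ,
                  λ w w-per → w zero , period1-multiple w-per
  ... | no  S≢2 = (λ _ → + 0) , zero-period1 ,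
                  λ w w-per → + 0 , λ i → period1-vanishes S≢2 w-per i

-- For 0 < m, t < N: x₁ and x_{m+1} are joined in P_N^{(t)}.
Adjacent : ℕ → ℕ → ℕ → Set
Adjacent N t m = t ≡ m ⊎ m ℕ.+ t ≡ N

n∣m<n+n⇒m≡n : ∀ {m n} → n ∣ m → 0 < m → m < n ℕ.+ n → m ≡ n
n∣m<n+n⇒m≡n (divides zero          refl) () _
n∣m<n+n⇒m≡n (divides (suc zero)    refl) _  _ = ℕ.+-identityʳ _
n∣m<n+n⇒m≡n {n = n} (divides (suc (suc q)) refl) _ m<n+n =
  ⊥-elim (<⇒≱ m<n+n (ℕ.+-monoʳ-≤ n (ℕ.m≤m+n n (q ℕ.* n))))

AdjacentMod : (N t m : ℕ) → .{{ℕ.NonZero N}} → Set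
AdjacentMod N t m = t % N ≡ m % N ⊎ (m ℕ.+ t) % N ≡ 0

adjacentMod? : ∀ N t m .{{_ : ℕ.NonZero N}} → Dec (AdjacentMod N t m)
adjacentMod? N t m = (t % N ℕ.≟ m % N) ⊎-dec ((m ℕ.+ t) % N ℕ.≟ 0)

prim-first-row : ∀ {n t} (i : Fin n) →
  prim (suc n) t zero (suc i)
    ≡ (if does (adjacentMod? (suc n) t (suc (toℕ i))) then - + 1 else + 0)
prim-first-row i = refl

adjacent⇒adjacentMod : ∀ {n t m} → Adjacent (suc n) t m → AdjacentMod (suc n) t m
adjacent⇒adjacentMod {n} =
  Sum.map (cong (_% suc n)) (λ m+t≡N → trans (cong (_% suc n) m+t≡N) (n%n≡0 (suc n)))

adjacentMod⇒adjacent : ∀ {n t m} → t < suc n → 0 < m → m < suc n →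
  AdjacentMod (suc n) t m → Adjacent (suc n) t m
adjacentMod⇒adjacent {n} {t} {m} t<N 0<m m<N = Sum.map
  (λ eq → trans (sym (m<n⇒m%n≡m t<N)) (trans eq (m<n⇒m%n≡m m<N)))
  (λ eq → n∣m<n+n⇒m≡n (m%n≡0⇒n∣m _ (suc n) eq)
                       (ℕ.<-≤-trans 0<m (ℕ.m≤m+n m t)) (ℕ.+-mono-< m<N t<N))

prim-first-row-adjacent : ∀ {n t} (j : Fin (suc n)) → toℕ j ≢ 0 →
  Adjacent (suc n) t (toℕ j) → prim (suc n) t zero j ≡ - + 1
prim-first-row-adjacent zero    j≢0 _   = ⊥-elim (j≢0 refl)
prim-first-row-adjacent {n} {t} (suc i) _   adj = trans (prim-first-row i)
  (cong (λ b → if b then - + 1 else + 0)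
    (dec-true (adjacentMod? (suc n) t (suc (toℕ i))) (adjacent⇒adjacentMod adj)))

prim-first-row-nonadjacent : ∀ {n t} (j : Fin (suc n)) → toℕ j ≢ 0 → t < suc n →
  ¬ Adjacent (suc n) t (toℕ j) → prim (suc n) t zero j ≡ + 0
prim-first-row-nonadjacent zero    j≢0 _   _    = ⊥-elim (j≢0 refl)
prim-first-row-nonadjacent {n} {t} (suc i) _   t<N ¬adj = trans (prim-first-row i)
  (cong (λ b → if b then - + 1 else + 0) (dec-false (adjacentMod? (suc n) t (suc (toℕ i)))
    (λ adj → ¬adj (adjacentMod⇒adjacent t<N (s≤s z≤n) (toℕ<n (suc i)) adj))))

primCombo-first-row : ∀ {n r t₀} (c : ℕ → ℤ) m → 1 ≤ m → m ≤ n → r < suc n →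
  1 ≤ t₀ → t₀ ≤ r → Adjacent (suc n) t₀ m →
  (∀ t → 1 ≤ t → t ≤ r → Adjacent (suc n) t m → t ≡ t₀) →
  primCombo (suc n) r c zero (fromℕ-mod m) ≡ - c t₀
primCombo-first-row {n} {r} {t₀} c m 1≤m m≤n r<N 1≤t₀ t₀≤r adj unique = begin
  primCombo (suc n) r c zero j   ≡⟨ sumTo-single r 1≤t₀ t₀≤r other-term ⟩
  c t₀ * prim (suc n) t₀ zero j  ≡⟨ cong (c t₀ *_) (prim-first-row-adjacent j j≢0 adj′) ⟩
  c t₀ * - + 1                   ≡⟨ ℤ.*-comm (c t₀) (- + 1) ⟩
  - + 1 * c t₀                   ≡⟨ ℤ.-1*i≡-i (c t₀) ⟩
  - c t₀                         ∎
  where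
  j = fromℕ-mod m
  toℕ-j : toℕ j ≡ m
  toℕ-j = toℕ-fromℕ-mod (s≤s m≤n)
  j≢0 : toℕ j ≢ 0
  j≢0 eq = <⇒≢ 1≤m (sym (trans (sym toℕ-j) eq))
  adj′ : Adjacent (suc n) t₀ (toℕ j)
  adj′ = subst (Adjacent (suc n) t₀) (sym toℕ-j) adj
  other-term : ∀ t → 1 ≤ t → t ≤ r → t ≢ t₀ → c t * prim (suc n) t zero j ≡ + 0
  other-term t 1≤t t≤r t≢t₀ = trans
    (cong (c t *_) (prim-first-row-nonadjacent j j≢0 (ℕ.≤-<-trans t≤r r<N)
      (λ adj′ → t≢t₀ (unique t 1≤t t≤r (subst (Adjacent (suc n) t) toℕ-j adj′)))))
    (ℤ.*-zeroʳ (c t))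

adjacent-lower-unique : ∀ {r b m t} → r ≤ suc b → m ≤ r → t ≤ r →
  Adjacent (suc (r ℕ.+ b)) t m → t ≡ m
adjacent-lower-unique _ _ _ (inj₁ t≡m) = t≡m
adjacent-lower-unique {r} {b} {m} {t} r≤1+b m≤r t≤r (inj₂ m+t≡N) =
  trans (≡r t≤r (ℕ.+-mono-≤-< m≤r)) (sym (≡r m≤r (λ m<r → ℕ.+-mono-<-≤ m<r t≤r)))
  where
  r+r≤m+t : r ℕ.+ r ≤ m ℕ.+ t
  r+r≤m+t = subst (r ℕ.+ r ≤_) (trans (ℕ.+-suc r b) (sym m+t≡N)) (ℕ.+-monoʳ-≤ r r≤1+b)
  ≡r : ∀ {x} → x ≤ r → (x < r → m ℕ.+ t < r ℕ.+ r) → x ≡ r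
  ≡r x≤r x<r⇒m+t<r+r = ≤-antisym x≤r (≮⇒≥ (λ x<r → <⇒≱ (x<r⇒m+t<r+r x<r) r+r≤m+t))

m+k+[1+n∸k]≡1+[m+n] : ∀ {r b k} → k ≤ b → r ℕ.+ k ℕ.+ (suc b ∸ k) ≡ suc (r ℕ.+ b)
m+k+[1+n∸k]≡1+[m+n] {r} {b} {k} k≤b = begin
  r ℕ.+ k ℕ.+ (suc b ∸ k)   ≡⟨ ℕ.+-assoc r k _ ⟩
  r ℕ.+ (k ℕ.+ (suc b ∸ k)) ≡⟨ cong (r ℕ.+_) (ℕ.m+[n∸m]≡n (m≤n⇒m≤1+n k≤b)) ⟩
  r ℕ.+ suc b               ≡⟨ ℕ.+-suc r b ⟩
  suc (r ℕ.+ b)             ∎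

adjacent-upper-unique : ∀ {r b k t} → 1 ≤ k → k ≤ b → t ≤ r →
  Adjacent (suc (r ℕ.+ b)) t (r ℕ.+ k) → t ≡ suc b ∸ k
adjacent-upper-unique {r} 1≤k _ t≤r (inj₁ t≡r+k) =
  ⊥-elim (<⇒≢ (ℕ.≤-<-trans t≤r (ℕ.m<m+n r 1≤k)) t≡r+k)
adjacent-upper-unique {r} {b} {k} {t} _ k≤b _ (inj₂ r+k+t≡N) =
  ℕ.+-cancelˡ-≡ (r ℕ.+ k) t (suc b ∸ k) (trans r+k+t≡N (sym (m+k+[1+n∸k]≡1+[m+n] k≤b)))

-- x_{r+k+1} is joined to x₁ only in P_N^{(b+1-k)}: the upper half of the first row
-- is the lower half read backwards.
firstRowSum-primCombo : ∀ {n} r b (c : ℕ → ℤ) (B : Matrix (suc n)) →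
  n ≡ r ℕ.+ b → b ≤ r → r ≤ suc b →
  (∀ j → B zero j ≡ primCombo (suc n) r c zero j) →
  firstRowSum B n ≡ sumTo r (λ t → [ c t ]₋) + sumTo b (λ t → [ c t ]₋)
firstRowSum-primCombo r b c B refl b≤r r≤1+b row = begin
  firstRowSum B (r ℕ.+ b)                    ≡⟨ sumTo-+ r b p ⟩
  sumTo r p + sumTo b (λ k → p (r ℕ.+ k))    ≡⟨ cong₂ _+_ (sumTo-cong r lower) (sumTo-cong b upper) ⟩
  sumTo r f + sumTo b (λ k → f (suc b ∸ k))  ≡⟨ cong (_+_ (sumTo r f)) (sumTo-reverse b f) ⟩
  sumTo r f + sumTo b f                      ∎
  where
  p f : ℕ → ℤ
  p m = [ B zero (fromℕ-mod m) ]₊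
  f t = [ c t ]₋
  entry : ∀ {m t₀} → 1 ≤ m → m ≤ r ℕ.+ b → 1 ≤ t₀ → t₀ ≤ r →
    Adjacent (suc (r ℕ.+ b)) t₀ m →
    (∀ t → 1 ≤ t → t ≤ r → Adjacent (suc (r ℕ.+ b)) t m → t ≡ t₀) → p m ≡ f t₀
  entry 1≤m m≤n 1≤t₀ t₀≤r adj unique = cong [_]₊
    (trans (row _) (primCombo-first-row c _ 1≤m m≤n (s≤s (ℕ.m≤m+n r b)) 1≤t₀ t₀≤r adj unique))
  lower : ∀ m → 1 ≤ m → m ≤ r → p m ≡ f m
  lower m 1≤m m≤r = entry 1≤m (≤-trans m≤r (ℕ.m≤m+n r b)) 1≤m m≤r (inj₁ refl)
    (λ t _ t≤r → adjacent-lower-unique r≤1+b m≤r t≤r)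
  upper : ∀ k → 1 ≤ k → k ≤ b → p (r ℕ.+ k) ≡ f (suc b ∸ k)
  upper k 1≤k k≤b = entry (≤-trans 1≤k (ℕ.m≤n+m k r)) (ℕ.+-monoʳ-≤ r k≤b)
    (ℕ.m<n⇒0<n∸m (s≤s k≤b)) (≤-trans (ℕ.∸-monoʳ-≤ (suc b) 1≤k) b≤r)
    (inj₂ (m+k+[1+n∸k]≡1+[m+n] k≤b)) (λ t _ t≤r → adjacent-upper-unique 1≤k k≤b t≤r)

period1-odd : ∀ {n} r (c : ℕ → ℤ) (B : Matrix (suc n)) → n ≡ r ℕ.+ r →
  (∀ j → B zero j ≡ primCombo (suc n) r c zero j) →
  (∃[ w ] (IsPeriod1Weight B w × ∃[ i ] w i ≢ + 0)) ⇔ (sumTo r (λ t → [ c t ]₋) ≡ + 1)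
period1-odd {n} r c B n≡r+r row = ⇔.trans (nonzero-period1⇔ B) (mk⇔
  (λ S≡2 → ℤ.*-cancelˡ-≡ (+ 2) _ (+ 1) (trans (sym (double x)) (trans (sym S≡x+x) S≡2)))
  (λ x≡1 → trans S≡x+x (cong₂ _+_ x≡1 x≡1)))
  where
  x = sumTo r (λ t → [ c t ]₋)
  S≡x+x : firstRowSum B n ≡ x + x
  S≡x+x = firstRowSum-primCombo r r c B n≡r+r ≤-refl (ℕ.n≤1+n r) row
  double : ∀ y → y + y ≡ + 2 * y
  double = solve-∀

period1-even : ∀ {n} r (c : ℕ → ℤ) (B : Matrix (suc n)) → suc n ≡ r ℕ.+ r →
  (∀ j → B zero j ≡ primCombo (suc n) r c zero j) →
  (∃[ w ] (IsPeriod1Weight B w × ∃[ i ] w i ≢ + 0))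
    ⇔ (+ 2 * sumTo (r ∸ 1) (λ t → [ c t ]₋) + [ c r ]₋ ≡ + 2)
period1-even zero    c B () row
period1-even {n} (suc b) c B 1+n≡r+r row = ⇔.trans (nonzero-period1⇔ B) (mk⇔
  (trans (sym S≡2x+y)) (trans S≡2x+y))
  where
  f : ℕ → ℤ
  f t = [ c t ]₋
  S≡2x+y : firstRowSum B n ≡ + 2 * sumTo b f + f (suc b)
  S≡2x+y = trans
    (firstRowSum-primCombo (suc b) b c B (trans (ℕ.suc-injective 1+n≡r+r) (ℕ.+-suc b b))
                           (ℕ.n≤1+n b) ≤-refl row)
    (regroup (sumTo b f) (f (suc b)))
    where
    regroup : ∀ x y → x + y + x ≡ + 2 * x + y
    regroup = solve-∀

m≡m%2+[m/2+m/2] : ∀ m → m ≡ m % 2 ℕ.+ (m / 2 ℕ.+ m / 2)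
m≡m%2+[m/2+m/2] m = trans (m≡m%n+[m/n]*n m 2)
  (cong (m % 2 ℕ.+_) (trans (ℕ.*-comm (m / 2) 2) (cong (m / 2 ℕ.+_) (ℕ.+-identityʳ (m / 2)))))

theorem2 : (N : ℕ) → 2 ≤ N → (c : ℕ → ℤ) → (B B′ : Matrix N) →
    IsSkew B → IsPeriod1Quiver B →
    IsSkew B′ → FirstRowColZero B′ →
    (∀ i j → B i j ≡ primCombo N (N / 2) c i j + B′ i j) →
    ((N % 2 ≡ 1) →
       ((∃[ w ] (IsPeriod1Weight B w × ∃[ i ] w i ≢ + 0))
         ⇔ (sumTo (N / 2) (λ t → [ c t ]₋) ≡ + 1)))
    × ((N % 2 ≡ 0) →
       ((∃[ w ] (IsPeriod1Weight B w × ∃[ i ] w i ≢ + 0))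
         ⇔ ((+ 2) * sumTo (N / 2 ∸ 1) (λ t → [ c t ]₋) + [ c (N / 2) ]₋ ≡ + 2)))
    × (∃[ w₀ ] (IsPeriod1Weight B w₀
         × (∀ w → IsPeriod1Weight B w → ∃[ k ] (∀ i → w i ≡ k * w₀ i))))
theorem2 (suc n) _ c B B′ _ _ _ (B′-row₀ , _) B≡ =
    (λ odd → period1-odd (suc n / 2) c B (ℕ.suc-injective (N≡ odd)) row)
  , (λ even → period1-even (suc n / 2) c B (N≡ even) row)
  , period1-unique B
  where
  N≡ : ∀ {ρ} → suc n % 2 ≡ ρ → suc n ≡ ρ ℕ.+ (suc n / 2 ℕ.+ suc n / 2)
  N≡ refl = m≡m%2+[m/2+m/2] (suc n)
  row : ∀ j → B zero j ≡ primCombo (suc n) (suc n / 2) c zero j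
  row j = begin
    B zero j        ≡⟨ B≡ zero j ⟩
    P j + B′ zero j ≡⟨ cong (_+_ (P j)) (B′-row₀ j) ⟩
    P j + + 0       ≡⟨ ℤ.+-identityʳ (P j) ⟩
    P j             ∎
    where
    P = primCombo (suc n) (suc n / 2) c zero
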